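{- Let $(S_1,\prec_1,\lhd_1)$ and $(S_2,\prec_2,\lhd_2)$ be Burling sets with $S_1\cap S_2=\{q\}$, where $q$ is a root of $(S_1,\prec_1,\lhd_1)$ and is exposed in $(S_2,\prec_2,\lhd_2)$. Then $(S_1\cup S_2,\ {\prec_1}\cup{\prec_2},\ {\lhd_1}\cup{\lhd_2})$ is a Burling set in which every root of $(S_2,\prec_2,\lhd_2)$ is a root, every probe of $(S_1,\prec_1,\lhd_1)$ or of $(S_2,\prec_2,\lhd_2)$ other than $q$ is a probe, and $q$ is exposed.
   Context: Relations are viewed as sets of ordered pairs. A Burling set is a triple $(S,\prec,\lhd)$ where $S$ is a non-empty finite set, $\prec$ is a strict partial order on $S$, $\lhd$ is an acyclic relation on $S$, and for all $x,y,z\in S$: (A1) if $x\prec y$, $x\prec z$, $y\ne z$, then $y\prec z$ or $z\prec y$; (A2) if $x\lhd y$, $x\lhd z$, $y\neq z$, then $y\prec z$ or $z\prec y$; (A3) if $x\lhd y$ and $x\prec z$, then $y\prec z$; (A4) if $x\lhd y$ and $y\prec z$, then $x\lhd z$ or $x\prec z$. In a Burling set $(S,\prec,\lhd)$: a root is $s\in S$ with no $x\in S$ such that $s\prec x$ or $s\lhd x$; a probe is $p\in S$ with no $x\in S$ such that $p\prec x$, $x\prec p$, or $x\lhd p$; an element $q\in S$ is exposed if there is no $x\in S$ with $q\prec x$. -}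

module Defs where

open import Level using (0ℓ)
open import Data.List using (List; _++_)
open import Data.List.Membership.Propositional using (_∈_)
open import Data.Product using (_×_; ∃)
open import Data.Sum using (_⊎_)
open import Relation.Nullary using (¬_)
open import Relation.Binary.Core using (Rel)
open import Relation.Binary.PropositionalEquality using (_≡_; _≢_)
open import Relation.Binary.Construct.Closure.Transitive using (TransClosure)

-- Elements live in an ambient type A; a finite set S ⊆ A is given by a list
-- (its elements are those x with x ∈ S).  Relations are binary predicates on A,
-- required to only relate elements of S (they are subsets of S × S).

_∪ᴿ_ : {A : Set} → Rel A 0ℓ → Rel A 0ℓ → Rel A 0ℓ
(R ∪ᴿ T) x y = R x y ⊎ T x y

Acyclic : {A : Set} → Rel A 0ℓ → Set
Acyclic {A} R = ∀ (x : A) → ¬ TransClosure R x x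

record IsBurling {A : Set} (S : List A) (_≺_ _◁_ : Rel A 0ℓ) : Set where
  field
    nonEmpty : ∃ λ x → x ∈ S
    ≺-dom    : ∀ {x y} → x ≺ y → x ∈ S × y ∈ S
    ◁-dom    : ∀ {x y} → x ◁ y → x ∈ S × y ∈ S
    ≺-irrefl : ∀ {x} → x ∈ S → ¬ (x ≺ x)
    ≺-trans  : ∀ {x y z} → x ∈ S → y ∈ S → z ∈ S → x ≺ y → y ≺ z → x ≺ z
    ◁-acyclic : Acyclic _◁_
    A1 : ∀ {x y z} → x ∈ S → y ∈ S → z ∈ S →
         x ≺ y → x ≺ z → y ≢ z → (y ≺ z) ⊎ (z ≺ y)
    A2 : ∀ {x y z} → x ∈ S → y ∈ S → z ∈ S →
         x ◁ y → x ◁ z → y ≢ z → (y ≺ z) ⊎ (z ≺ y)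
    A3 : ∀ {x y z} → x ∈ S → y ∈ S → z ∈ S →
         x ◁ y → x ≺ z → y ≺ z
    A4 : ∀ {x y z} → x ∈ S → y ∈ S → z ∈ S →
         x ◁ y → y ≺ z → (x ◁ z) ⊎ (x ≺ z)

module _ {A : Set} (S : List A) (_≺_ _◁_ : Rel A 0ℓ) where

  IsRoot : A → Set
  IsRoot s = s ∈ S × (∀ x → x ∈ S → ¬ (s ≺ x) × ¬ (s ◁ x))

  IsProbe : A → Set
  IsProbe p = p ∈ S × (∀ x → x ∈ S → ¬ (p ≺ x) × ¬ (x ≺ p) × ¬ (x ◁ p))

  IsExposed : A → Set
  IsExposed q = q ∈ S × (∀ x → x ∈ S → ¬ (q ≺ x))

-- As q is a root of S₁, no element
-- of S₂ starts a ≺₁- or ◁₁-edge; as q is exposed in S₂, no element of S₁ starts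
-- a ≺₂-edge.  So no instance of an axiom in the union mixes edges of the two
-- sets, and a ◁-cycle, which would have to pass from a ◁₂-edge to a ◁₁-edge,
-- cannot exist.
module Submission where

open import Defs
open import Level using (0ℓ)
open import Data.List using (List; _++_)
open import Data.List.Membership.Propositional using (_∈_; _∉_)
open import Data.List.Membership.Propositional.Properties using (∈-++⁺ˡ; ∈-++⁺ʳ)
open import Data.Product using (_×_; _,_; proj₁; proj₂; ∃)
open import Data.Sum using (_⊎_; inj₁; inj₂)
import Data.Sum as Sum
open import Data.Empty using (⊥-elim)
open import Relation.Nullary using (¬_)
open import Relation.Binary.Core using (Rel)
open import Relation.Binary.PropositionalEquality using (_≡_; _≢_; refl)
open import Relation.Binary.Construct.Closure.Transitive using (TransClosure; [_]; _∷_)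
open import Relation.Binary.Construct.Closure.ReflexiveTransitive using (Star; ε; _◅_)

module _ {A : Set} {R T : Rel A 0ℓ} (T-then-R : ∀ {x y z} → T x y → ¬ R y z) where

  T⁺-then-R : ∀ {x y z} → TransClosure T x y → ¬ R y z
  T⁺-then-R [ t ]     = T-then-R t
  T⁺-then-R (_ ∷ ts) = T⁺-then-R ts

  ∪-path-split : ∀ {x z} → TransClosure (R ∪ᴿ T) x z →
    TransClosure R x z ⊎ ∃ λ w → Star R x w × TransClosure T w z
  ∪-path-split [ inj₁ r ] = inj₁ [ r ]
  ∪-path-split [ inj₂ t ] = inj₂ (_ , ε , [ t ])
  ∪-path-split (inj₁ r ∷ p) with ∪-path-split p
  ... | inj₁ rs            = inj₁ (r ∷ rs)
  ... | inj₂ (w , rs , ts) = inj₂ (w , r ◅ rs , ts)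
  ∪-path-split (inj₂ t ∷ p) with ∪-path-split p
  ... | inj₁ [ r ]            = ⊥-elim (T-then-R t r)
  ... | inj₁ (r ∷ _)          = ⊥-elim (T-then-R t r)
  ... | inj₂ (_ , ε , ts)     = inj₂ (_ , ε , t ∷ ts)
  ... | inj₂ (_ , r ◅ _ , _) = ⊥-elim (T-then-R t r)

  ∪-acyclic : Acyclic R → Acyclic T → Acyclic (R ∪ᴿ T)
  ∪-acyclic R-acyclic T-acyclic x cycle with ∪-path-split cycle
  ... | inj₁ rs               = R-acyclic x rs
  ... | inj₂ (_ , ε , ts)     = T-acyclic x ts
  ... | inj₂ (_ , r ◅ _ , ts) = T⁺-then-R ts r

no-successor-outside : {A : Set} {S T : List A} {R : Rel A 0ℓ} {q : A} →
  (∀ {x y} → R x y → x ∈ S × y ∈ S) → (∀ {x} → x ∈ S → x ∈ T → x ≡ q) →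
  (∀ y → y ∈ S → ¬ R q y) → ∀ {x y} → x ∈ T → ¬ R x y
no-successor-outside R-dom shared q-maximal x∈T xRy
  with shared (proj₁ (R-dom xRy)) x∈T
... | refl = q-maximal _ (proj₂ (R-dom xRy)) xRy

module Burling {A : Set} {S : List A} {_≺_ _◁_ : Rel A 0ℓ} (B : IsBurling S _≺_ _◁_) where
  open IsBurling B using (≺-dom; ◁-dom)
  private module B = IsBurling B

  ≺-src : ∀ {x y} → x ≺ y → x ∈ S
  ≺-src p = proj₁ (≺-dom p)

  ≺-tgt : ∀ {x y} → x ≺ y → y ∈ S
  ≺-tgt p = proj₂ (≺-dom p)

  ◁-src : ∀ {x y} → x ◁ y → x ∈ S
  ◁-src p = proj₁ (◁-dom p)

  ◁-tgt : ∀ {x y} → x ◁ y → y ∈ S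
  ◁-tgt p = proj₂ (◁-dom p)

  ≺-irrefl′ : ∀ {x} → ¬ (x ≺ x)
  ≺-irrefl′ p = B.≺-irrefl (≺-src p) p

  ≺-trans′ : ∀ {x y z} → x ≺ y → y ≺ z → x ≺ z
  ≺-trans′ p q = B.≺-trans (≺-src p) (≺-tgt p) (≺-tgt q) p q

  A1′ : ∀ {x y z} → x ≺ y → x ≺ z → y ≢ z → (y ≺ z) ⊎ (z ≺ y)
  A1′ p q = B.A1 (≺-src p) (≺-tgt p) (≺-tgt q) p q

  A2′ : ∀ {x y z} → x ◁ y → x ◁ z → y ≢ z → (y ≺ z) ⊎ (z ≺ y)
  A2′ p q = B.A2 (◁-src p) (◁-tgt p) (◁-tgt q) p q

  A3′ : ∀ {x y z} → x ◁ y → x ≺ z → y ≺ z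
  A3′ p q = B.A3 (◁-src p) (◁-tgt p) (≺-tgt q) p q

  A4′ : ∀ {x y z} → x ◁ y → y ≺ z → (x ◁ z) ⊎ (x ≺ z)
  A4′ p q = B.A4 (◁-src p) (◁-tgt p) (≺-tgt q) p q

module Union {A : Set} {S₁ S₂ : List A} {≺₁ ◁₁ ≺₂ ◁₂ : Rel A 0ℓ}
  (B₁ : IsBurling S₁ ≺₁ ◁₁) (B₂ : IsBurling S₂ ≺₂ ◁₂) where
  private
    module B₁ = Burling B₁
    module B₂ = Burling B₂
    S = S₁ ++ S₂
    _≺_ = ≺₁ ∪ᴿ ≺₂
    _◁_ = ◁₁ ∪ᴿ ◁₂

  ∈-union₁ : ∀ {x} → x ∈ S₁ → x ∈ S
  ∈-union₁ = ∈-++⁺ˡ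

  ∈-union₂ : ∀ {x} → x ∈ S₂ → x ∈ S
  ∈-union₂ = ∈-++⁺ʳ S₁

  probe₁-preserved : ∀ {p} → IsProbe S₁ ≺₁ ◁₁ p → p ∉ S₂ → IsProbe S _≺_ _◁_ p
  probe₁-preserved (p∈S₁ , isolated) p∉S₂ = ∈-union₁ p∈S₁ , λ x _ →
    (λ { (inj₁ h) → proj₁ (isolated x (B₁.≺-tgt h)) h
       ; (inj₂ h) → p∉S₂ (B₂.≺-src h) }) ,
    (λ { (inj₁ h) → proj₁ (proj₂ (isolated x (B₁.≺-src h))) h
       ; (inj₂ h) → p∉S₂ (B₂.≺-tgt h) }) ,
    (λ { (inj₁ h) → proj₂ (proj₂ (isolated x (B₁.◁-src h))) h
       ; (inj₂ h) → p∉S₂ (B₂.◁-tgt h) })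

  probe₂-preserved : ∀ {p} → IsProbe S₂ ≺₂ ◁₂ p → p ∉ S₁ → IsProbe S _≺_ _◁_ p
  probe₂-preserved (p∈S₂ , isolated) p∉S₁ = ∈-union₂ p∈S₂ , λ x _ →
    (λ { (inj₁ h) → p∉S₁ (B₁.≺-src h)
       ; (inj₂ h) → proj₁ (isolated x (B₂.≺-tgt h)) h }) ,
    (λ { (inj₁ h) → p∉S₁ (B₁.≺-tgt h)
       ; (inj₂ h) → proj₁ (proj₂ (isolated x (B₂.≺-src h))) h }) ,
    (λ { (inj₁ h) → p∉S₁ (B₁.◁-tgt h)
       ; (inj₂ h) → proj₂ (proj₂ (isolated x (B₂.◁-src h))) h })

  module Glued (≺₁-not-from-S₂ : ∀ {x y} → x ∈ S₂ → ¬ ≺₁ x y)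
           (◁₁-not-from-S₂ : ∀ {x y} → x ∈ S₂ → ¬ ◁₁ x y)
           (≺₂-not-from-S₁ : ∀ {x y} → x ∈ S₁ → ¬ ≺₂ x y) where

    union-isBurling : IsBurling S _≺_ _◁_
    union-isBurling = record
      { nonEmpty  = proj₁ (IsBurling.nonEmpty B₁) , ∈-union₁ (proj₂ (IsBurling.nonEmpty B₁))
      ; ≺-dom     = λ { (inj₁ h) → ∈-union₁ (B₁.≺-src h) , ∈-union₁ (B₁.≺-tgt h)
                      ; (inj₂ h) → ∈-union₂ (B₂.≺-src h) , ∈-union₂ (B₂.≺-tgt h) }
      ; ◁-dom     = λ { (inj₁ h) → ∈-union₁ (B₁.◁-src h) , ∈-union₁ (B₁.◁-tgt h)
                      ; (inj₂ h) → ∈-union₂ (B₂.◁-src h) , ∈-union₂ (B₂.◁-tgt h) }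
      ; ≺-irrefl  = λ { _ (inj₁ h) → B₁.≺-irrefl′ h ; _ (inj₂ h) → B₂.≺-irrefl′ h }
      ; ≺-trans   = λ _ _ _ → trans
      ; ◁-acyclic = ∪-acyclic (λ h → ◁₁-not-from-S₂ (B₂.◁-tgt h))
                      (IsBurling.◁-acyclic B₁) (IsBurling.◁-acyclic B₂)
      ; A1        = λ _ _ _ → a1
      ; A2        = λ _ _ _ → a2
      ; A3        = λ _ _ _ → a3
      ; A4        = λ _ _ _ → a4
      }
      where
      trans : ∀ {x y z} → x ≺ y → y ≺ z → x ≺ z
      trans (inj₁ h) (inj₁ k) = inj₁ (B₁.≺-trans′ h k)
      trans (inj₂ h) (inj₂ k) = inj₂ (B₂.≺-trans′ h k)
      trans (inj₁ h) (inj₂ k) = ⊥-elim (≺₂-not-from-S₁ (B₁.≺-tgt h) k)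
      trans (inj₂ h) (inj₁ k) = ⊥-elim (≺₁-not-from-S₂ (B₂.≺-tgt h) k)

      a1 : ∀ {x y z} → x ≺ y → x ≺ z → y ≢ z → (y ≺ z) ⊎ (z ≺ y)
      a1 (inj₁ h) (inj₁ k) y≢z = Sum.map inj₁ inj₁ (B₁.A1′ h k y≢z)
      a1 (inj₂ h) (inj₂ k) y≢z = Sum.map inj₂ inj₂ (B₂.A1′ h k y≢z)
      a1 (inj₁ h) (inj₂ k) _   = ⊥-elim (≺₁-not-from-S₂ (B₂.≺-src k) h)
      a1 (inj₂ h) (inj₁ k) _   = ⊥-elim (≺₁-not-from-S₂ (B₂.≺-src h) k)

      a2 : ∀ {x y z} → x ◁ y → x ◁ z → y ≢ z → (y ≺ z) ⊎ (z ≺ y)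
      a2 (inj₁ h) (inj₁ k) y≢z = Sum.map inj₁ inj₁ (B₁.A2′ h k y≢z)
      a2 (inj₂ h) (inj₂ k) y≢z = Sum.map inj₂ inj₂ (B₂.A2′ h k y≢z)
      a2 (inj₁ h) (inj₂ k) _   = ⊥-elim (◁₁-not-from-S₂ (B₂.◁-src k) h)
      a2 (inj₂ h) (inj₁ k) _   = ⊥-elim (◁₁-not-from-S₂ (B₂.◁-src h) k)

      a3 : ∀ {x y z} → x ◁ y → x ≺ z → y ≺ z
      a3 (inj₁ h) (inj₁ k) = inj₁ (B₁.A3′ h k)
      a3 (inj₂ h) (inj₂ k) = inj₂ (B₂.A3′ h k)
      a3 (inj₁ h) (inj₂ k) = ⊥-elim (◁₁-not-from-S₂ (B₂.≺-src k) h)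
      a3 (inj₂ h) (inj₁ k) = ⊥-elim (≺₁-not-from-S₂ (B₂.◁-src h) k)

      a4 : ∀ {x y z} → x ◁ y → y ≺ z → (x ◁ z) ⊎ (x ≺ z)
      a4 (inj₁ h) (inj₁ k) = Sum.map inj₁ inj₁ (B₁.A4′ h k)
      a4 (inj₂ h) (inj₂ k) = Sum.map inj₂ inj₂ (B₂.A4′ h k)
      a4 (inj₁ h) (inj₂ k) = ⊥-elim (≺₂-not-from-S₁ (B₁.◁-tgt h) k)
      a4 (inj₂ h) (inj₁ k) = ⊥-elim (≺₁-not-from-S₂ (B₂.◁-tgt h) k)

    root₂-preserved : ∀ {r} → IsRoot S₂ ≺₂ ◁₂ r → IsRoot S _≺_ _◁_ r
    root₂-preserved (r∈S₂ , maximal) = ∈-union₂ r∈S₂ , λ x _ →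
      (λ { (inj₁ h) → ≺₁-not-from-S₂ r∈S₂ h
         ; (inj₂ h) → proj₁ (maximal x (B₂.≺-tgt h)) h }) ,
      (λ { (inj₁ h) → ◁₁-not-from-S₂ r∈S₂ h
         ; (inj₂ h) → proj₂ (maximal x (B₂.◁-tgt h)) h })

    exposed₂-preserved : ∀ {e} → IsExposed S₂ ≺₂ ◁₂ e → IsExposed S _≺_ _◁_ e
    exposed₂-preserved (e∈S₂ , maximal) = ∈-union₂ e∈S₂ , λ x _ →
      λ { (inj₁ h) → ≺₁-not-from-S₂ e∈S₂ h
        ; (inj₂ h) → maximal x (B₂.≺-tgt h) h }

mainTheorem8 : {A : Set} (S₁ S₂ : List A) (≺₁ ◁₁ ≺₂ ◁₂ : Rel A 0ℓ) (q : A) →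
    IsBurling S₁ ≺₁ ◁₁ → IsBurling S₂ ≺₂ ◁₂ →
    q ∈ S₁ → q ∈ S₂ → (∀ x → x ∈ S₁ → x ∈ S₂ → x ≡ q) →
    IsRoot S₁ ≺₁ ◁₁ q → IsExposed S₂ ≺₂ ◁₂ q →
    IsBurling (S₁ ++ S₂) (≺₁ ∪ᴿ ≺₂) (◁₁ ∪ᴿ ◁₂)
    × (∀ r → IsRoot S₂ ≺₂ ◁₂ r → IsRoot (S₁ ++ S₂) (≺₁ ∪ᴿ ≺₂) (◁₁ ∪ᴿ ◁₂) r)
    × (∀ p → (IsProbe S₁ ≺₁ ◁₁ p ⊎ IsProbe S₂ ≺₂ ◁₂ p) → p ≢ q →
         IsProbe (S₁ ++ S₂) (≺₁ ∪ᴿ ≺₂) (◁₁ ∪ᴿ ◁₂) p)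
    × IsExposed (S₁ ++ S₂) (≺₁ ∪ᴿ ≺₂) (◁₁ ∪ᴿ ◁₂) q
mainTheorem8 S₁ S₂ ≺₁ ◁₁ ≺₂ ◁₂ q B₁ B₂ _ _ shared q-root q-exposed =
  union-isBurling ,
  (λ _ → root₂-preserved) ,
  (λ where
    p (inj₁ probe) p≢q → probe₁-preserved probe (λ p∈S₂ → p≢q (shared p (proj₁ probe) p∈S₂))
    p (inj₂ probe) p≢q → probe₂-preserved probe (λ p∈S₁ → p≢q (shared p p∈S₁ (proj₁ probe)))) ,
  exposed₂-preserved q-exposed
  where
  open Union B₁ B₂

  ≺₁-not-from-S₂ : ∀ {x y} → x ∈ S₂ → ¬ ≺₁ x y
  ≺₁-not-from-S₂ = no-successor-outside (IsBurling.≺-dom B₁) (shared _)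
                     (λ y y∈S₁ → proj₁ (proj₂ q-root y y∈S₁))

  ◁₁-not-from-S₂ : ∀ {x y} → x ∈ S₂ → ¬ ◁₁ x y
  ◁₁-not-from-S₂ = no-successor-outside (IsBurling.◁-dom B₁) (shared _)
                     (λ y y∈S₁ → proj₂ (proj₂ q-root y y∈S₁))

  ≺₂-not-from-S₁ : ∀ {x y} → x ∈ S₁ → ¬ ≺₂ x y
  ≺₂-not-from-S₁ = no-successor-outside (IsBurling.≺-dom B₂) (λ x∈S₂ x∈S₁ → shared _ x∈S₁ x∈S₂)
                     (proj₂ q-exposed)

  open Glued ≺₁-not-from-S₂ ◁₁-not-from-S₂ ≺₂-not-from-S₁
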